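{- Let $G$ be a (not necessarily commutative) preordered group, $\vdash$ a regular entailment relation for $G$, and $V$ the distributive lattice it generates, with order $\leqslant_V$ and the induced left and right actions of $G$. For $a,b\in V$ define $u\leqslant^{a,b}v$ (for $u,v\in V$) by: $xa\wedge uy\leqslant_V xb\vee vy$ for all $x,y\in G$. Then $\leqslant^{a,b}$ is a preorder on $V$ defining a lattice quotient of $V$, invariant under the left and right actions of $G$, and such that $b\leqslant^{a,b}a$ when $a,b\in G$.
   Context: $G$ is a group (written multiplicatively) with a preorder $\leqslant$ such that $a\leqslant b$ implies $xay\leqslant xby$. $A,B,A',B'$ denote nonempty finite subsets of $G$; $a$ stands for $\{a\}$, commas denote unions, $xAy=\{xay:a\in A\}$. A regular entailment relation for $G$ is a relation $A\vdash B$ between nonempty finite subsets such that: (R1) $A\vdash B$ if $A\supseteq A'$, $B\supseteq B'$ and $A'\vdash B'$; (R2) $A\vdash B$ if $A,x\vdash B$ and $A\vdash B,x$; (R3) $a\vdash b$ if $a\leqslant b$; (R4) $A\vdash B$ if $xAy\vdash xBy$; (R5) $xa,by\vdash xb,ay$ for all $a,b,x,y\in G$. The distributive lattice $V$ generated by $\vdash$ is presented by generators $a\in G$ and relations $\bigwedge A\leqslant\bigvee B$ for $A\vdash B$; by (R4), left and right multiplication by elements of $G$ extend to lattice automorphisms of $V$ (the left and right actions). -}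

module Defs where

open import Data.List.NonEmpty using (List⁺; [_]; _⁺++⁺_; _∷⁺_; toList; foldr₁) renaming (map to map⁺)
open import Data.List.Membership.Propositional using (_∈_)
open import Relation.Binary.PropositionalEquality using (_≡_)

record PreorderedGroup : Set₁ where
  infixl 7 _·_
  infix 4 _≤_
  field
    Carrier   : Set
    _·_       : Carrier → Carrier → Carrier
    e         : Carrier
    _⁻¹       : Carrier → Carrier
    assoc     : ∀ x y z → (x · y) · z ≡ x · (y · z)
    identityˡ : ∀ x → e · x ≡ x
    identityʳ : ∀ x → x · e ≡ x
    inverseˡ  : ∀ x → (x ⁻¹) · x ≡ e
    inverseʳ  : ∀ x → x · (x ⁻¹) ≡ e
    _≤_       : Carrier → Carrier → Set
    ≤-refl    : ∀ {a} → a ≤ a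
    ≤-trans   : ∀ {a b c} → a ≤ b → b ≤ c → a ≤ c
    ≤-compat  : ∀ {a b} x y → a ≤ b → x · a · y ≤ x · b · y

module _ (G : PreorderedGroup) where
  open PreorderedGroup G

  -- Nonempty finite subsets of G, represented by nonempty lists
  -- (R1 makes entailment insensitive to order / repetitions).
  Fin⁺ : Set
  Fin⁺ = List⁺ Carrier

  _⊇_ : Fin⁺ → Fin⁺ → Set
  A ⊇ A' = ∀ {z} → z ∈ toList A' → z ∈ toList A

  _⟪_⟫_ : Carrier → Fin⁺ → Carrier → Fin⁺
  x ⟪ A ⟫ y = map⁺ (λ a → x · a · y) A

  record RegularEntailment : Set₁ where
    infix 3 _⊢_
    field
      _⊢_ : Fin⁺ → Fin⁺ → Set
      R1  : ∀ {A B A' B'} → A ⊇ A' → B ⊇ B' → A' ⊢ B' → A ⊢ B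
      R2  : ∀ {A B} x → (A ⁺++⁺ [ x ]) ⊢ B → A ⊢ (B ⁺++⁺ [ x ]) → A ⊢ B
      R3  : ∀ {a b} → a ≤ b → [ a ] ⊢ [ b ]
      R4  : ∀ {A B} x y → (x ⟪ A ⟫ y) ⊢ (x ⟪ B ⟫ y) → A ⊢ B
      R5  : ∀ a b x y → (x · a ∷⁺ [ b · y ]) ⊢ (x · b ∷⁺ [ a · y ])

  -- Lattice terms over G: elements of the distributive lattice V are
  -- represented by terms, with the order ≤V generated below.
  infixr 6 _∧_
  infixr 5 _∨_
  data Term : Set where
    gen : Carrier → Term
    _∧_ : Term → Term → Term
    _∨_ : Term → Term → Term

  ⋀ ⋁ : Fin⁺ → Term
  ⋀ A = foldr₁ _∧_ (map⁺ gen A)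
  ⋁ A = foldr₁ _∨_ (map⁺ gen A)

  _▹_ : Carrier → Term → Term
  x ▹ gen a = gen (x · a)
  x ▹ (u ∧ v) = (x ▹ u) ∧ (x ▹ v)
  x ▹ (u ∨ v) = (x ▹ u) ∨ (x ▹ v)

  _◃_ : Term → Carrier → Term
  gen a ◃ y = gen (a · y)
  (u ∧ v) ◃ y = (u ◃ y) ∧ (v ◃ y)
  (u ∨ v) ◃ y = (u ◃ y) ∨ (v ◃ y)

  module _ (E : RegularEntailment) where
    open RegularEntailment E

    infix 4 _≤V_
    data _≤V_ : Term → Term → Set where
      ≤V-refl  : ∀ {u} → u ≤V u
      ≤V-trans : ∀ {u v w} → u ≤V v → v ≤V w → u ≤V w
      ∧-lbˡ    : ∀ {u v} → u ∧ v ≤V u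
      ∧-lbʳ    : ∀ {u v} → u ∧ v ≤V v
      ∧-glb    : ∀ {u v w} → w ≤V u → w ≤V v → w ≤V u ∧ v
      ∨-ubˡ    : ∀ {u v} → u ≤V u ∨ v
      ∨-ubʳ    : ∀ {u v} → v ≤V u ∨ v
      ∨-lub    : ∀ {u v w} → u ≤V w → v ≤V w → u ∨ v ≤V w
      distrib  : ∀ {u v w} → u ∧ (v ∨ w) ≤V (u ∧ v) ∨ (u ∧ w)
      entail   : ∀ {A B} → A ⊢ B → ⋀ A ≤V ⋁ B

    _≤[_,_]_ : Term → Term → Term → Term → Set
    u ≤[ a , b ] v = ∀ x y → (x ▹ a) ∧ (u ◃ y) ≤V (x ▹ b) ∨ (v ◃ y)

    record DefinesLatticeQuotient (_≼_ : Term → Term → Set) : Set where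
      field
        refl′    : ∀ {u} → u ≼ u
        trans′   : ∀ {u v w} → u ≼ v → v ≼ w → u ≼ w
        extends  : ∀ {u v} → u ≤V v → u ≼ v
        meet     : ∀ {u v w} → w ≼ u → w ≼ v → w ≼ (u ∧ v)
        join     : ∀ {u v w} → u ≼ w → v ≼ w → (u ∨ v) ≼ w

    record ActionInvariant (_≼_ : Term → Term → Set) : Set where
      field
        left  : ∀ {u v} x → u ≼ v → (x ▹ u) ≼ (x ▹ v)
        right : ∀ {u v} y → u ≼ v → (u ◃ y) ≼ (v ◃ y)

{-# OPTIONS --safe #-}
module Submission where

-- Transitivity of ≤^{a,b} is a cut: from x a ∧ u y ≤ x b ∨ v y and
-- x a ∧ v y ≤ x b ∨ w y, meet the first with x a and distribute.  Closure under
-- meets uses the dual distributive law, and invariance holds because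
-- multiplication by z, z⁻¹ on the left or right is a lattice automorphism of V
-- (axiom R4) that permutes the quantified x, y.  Finally b ≤^{a,b} a for
-- generators is axiom R5 itself.

open import Defs hiding (_▹_; _◃_; _≤V_)
import Defs
open import Data.Product using (_×_; _,_)
open import Data.List using ([]; _∷_)
open import Data.List.NonEmpty using (_∷_) renaming (map to map⁺)
open import Data.List.NonEmpty.Properties using (map-∘; map-cong; map-id)
open import Function using (id)
open import Relation.Binary.PropositionalEquality
  using (_≡_; _≗_; refl; sym; trans; cong; cong₂; subst₂; module ≡-Reasoning)

module _ (G : PreorderedGroup) where
  open PreorderedGroup G

  x·[x⁻¹·y]≡y : ∀ x y → x · (x ⁻¹ · y) ≡ y
  x·[x⁻¹·y]≡y x y = begin
    x · (x ⁻¹ · y)  ≡⟨ sym (assoc x (x ⁻¹) y) ⟩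
    x · x ⁻¹ · y    ≡⟨ cong (_· y) (inverseʳ x) ⟩
    e · y           ≡⟨ identityˡ y ⟩
    y               ∎
    where open ≡-Reasoning

  x⁻¹·[x·z·y]·y⁻¹≡z : ∀ x y z → x ⁻¹ · (x · z · y) · y ⁻¹ ≡ z
  x⁻¹·[x·z·y]·y⁻¹≡z x y z = begin
    x ⁻¹ · (x · z · y) · y ⁻¹      ≡⟨ cong (_· y ⁻¹) (sym (assoc (x ⁻¹) (x · z) y)) ⟩
    x ⁻¹ · (x · z) · y · y ⁻¹      ≡⟨ assoc (x ⁻¹ · (x · z)) y (y ⁻¹) ⟩
    x ⁻¹ · (x · z) · (y · y ⁻¹)    ≡⟨ cong₂ _·_ (sym (assoc (x ⁻¹) x z)) (inverseʳ y) ⟩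
    x ⁻¹ · x · z · e               ≡⟨ identityʳ (x ⁻¹ · x · z) ⟩
    x ⁻¹ · x · z                   ≡⟨ cong (_· z) (inverseˡ x) ⟩
    e · z                          ≡⟨ identityˡ z ⟩
    z                              ∎
    where open ≡-Reasoning

  private
    infixr 8 _▹_
    infixl 8 _◃_

    _▹_ : Carrier → Term G → Term G
    _▹_ = Defs._▹_ G

    _◃_ : Term G → Carrier → Term G
    _◃_ = Defs._◃_ G

  mapTerm : (Carrier → Carrier) → Term G → Term G
  mapTerm f (gen a) = gen (f a)
  mapTerm f (u ∧ v) = mapTerm f u ∧ mapTerm f v
  mapTerm f (u ∨ v) = mapTerm f u ∨ mapTerm f v

  mapTerm-⋀ : ∀ f a as → mapTerm f (⋀ G (a ∷ as)) ≡ ⋀ G (map⁺ f (a ∷ as))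
  mapTerm-⋀ f a []       = refl
  mapTerm-⋀ f a (b ∷ bs) = cong (gen (f a) ∧_) (mapTerm-⋀ f b bs)

  mapTerm-⋁ : ∀ f a as → mapTerm f (⋁ G (a ∷ as)) ≡ ⋁ G (map⁺ f (a ∷ as))
  mapTerm-⋁ f a []       = refl
  mapTerm-⋁ f a (b ∷ bs) = cong (gen (f a) ∨_) (mapTerm-⋁ f b bs)

  ▹-mapTerm : ∀ x u → x ▹ u ≡ mapTerm (x ·_) u
  ▹-mapTerm x (gen a) = refl
  ▹-mapTerm x (u ∧ v) = cong₂ _∧_ (▹-mapTerm x u) (▹-mapTerm x v)
  ▹-mapTerm x (u ∨ v) = cong₂ _∨_ (▹-mapTerm x u) (▹-mapTerm x v)

  ◃-mapTerm : ∀ y u → u ◃ y ≡ mapTerm (_· y) u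
  ◃-mapTerm y (gen a) = refl
  ◃-mapTerm y (u ∧ v) = cong₂ _∧_ (◃-mapTerm y u) (◃-mapTerm y v)
  ◃-mapTerm y (u ∨ v) = cong₂ _∨_ (◃-mapTerm y u) (◃-mapTerm y v)

  ▹-▹ : ∀ x y u → x ▹ y ▹ u ≡ (x · y) ▹ u
  ▹-▹ x y (gen a) = cong gen (sym (assoc x y a))
  ▹-▹ x y (u ∧ v) = cong₂ _∧_ (▹-▹ x y u) (▹-▹ x y v)
  ▹-▹ x y (u ∨ v) = cong₂ _∨_ (▹-▹ x y u) (▹-▹ x y v)

  ◃-◃ : ∀ x y u → u ◃ x ◃ y ≡ u ◃ (x · y)
  ◃-◃ x y (gen a) = cong gen (assoc a x y)
  ◃-◃ x y (u ∧ v) = cong₂ _∧_ (◃-◃ x y u) (◃-◃ x y v)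
  ◃-◃ x y (u ∨ v) = cong₂ _∨_ (◃-◃ x y u) (◃-◃ x y v)

  ▹-◃ : ∀ x y u → x ▹ (u ◃ y) ≡ (x ▹ u) ◃ y
  ▹-◃ x y (gen a) = cong gen (sym (assoc x a y))
  ▹-◃ x y (u ∧ v) = cong₂ _∧_ (▹-◃ x y u) (▹-◃ x y v)
  ▹-◃ x y (u ∨ v) = cong₂ _∨_ (▹-◃ x y u) (▹-◃ x y v)

  ▹-▹-cancel : ∀ z x u → z ▹ (z ⁻¹ · x) ▹ u ≡ x ▹ u
  ▹-▹-cancel z x u = trans (▹-▹ z (z ⁻¹ · x) u) (cong (_▹ u) (x·[x⁻¹·y]≡y z x))

  module _ (E : RegularEntailment G) where
    open RegularEntailment E

    private
      infix 4 _≤V_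

      _≤V_ : Term G → Term G → Set
      _≤V_ = Defs._≤V_ G E

    PreservesEntailment : (Carrier → Carrier) → Set
    PreservesEntailment f = ∀ {A B} → A ⊢ B → map⁺ f A ⊢ map⁺ f B

    translation-preserves-⊢ : ∀ x y {f} → f ≗ (λ z → x · z · y) → PreservesEntailment f
    translation-preserves-⊢ x y {f} f≗ {A} {B} A⊢B =
      R4 (x ⁻¹) (y ⁻¹) (subst₂ _⊢_ (sym (untranslate A)) (sym (untranslate B)) A⊢B)
      where
      untranslate : ∀ C → map⁺ (λ c → x ⁻¹ · c · y ⁻¹) (map⁺ f C) ≡ C
      untranslate C = begin
        map⁺ (λ c → x ⁻¹ · c · y ⁻¹) (map⁺ f C)  ≡⟨ sym (map-∘ C) ⟩
        map⁺ (λ c → x ⁻¹ · f c · y ⁻¹) C         ≡⟨ map-cong cancel C ⟩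
        map⁺ id C                                ≡⟨ map-id C ⟩
        C                                        ∎
        where
        open ≡-Reasoning
        cancel : ∀ c → x ⁻¹ · f c · y ⁻¹ ≡ c
        cancel c = trans (cong (λ t → x ⁻¹ · t · y ⁻¹) (f≗ c)) (x⁻¹·[x·z·y]·y⁻¹≡z x y c)

    mapTerm-mono : ∀ {f} → PreservesEntailment f → ∀ {u v} → u ≤V v → mapTerm f u ≤V mapTerm f v
    mapTerm-mono f⊢ ≤V-refl       = ≤V-refl
    mapTerm-mono f⊢ (≤V-trans p q) = ≤V-trans (mapTerm-mono f⊢ p) (mapTerm-mono f⊢ q)
    mapTerm-mono f⊢ ∧-lbˡ         = ∧-lbˡ
    mapTerm-mono f⊢ ∧-lbʳ         = ∧-lbʳ
    mapTerm-mono f⊢ (∧-glb p q)   = ∧-glb (mapTerm-mono f⊢ p) (mapTerm-mono f⊢ q)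
    mapTerm-mono f⊢ ∨-ubˡ         = ∨-ubˡ
    mapTerm-mono f⊢ ∨-ubʳ         = ∨-ubʳ
    mapTerm-mono f⊢ (∨-lub p q)   = ∨-lub (mapTerm-mono f⊢ p) (mapTerm-mono f⊢ q)
    mapTerm-mono f⊢ distrib       = distrib
    mapTerm-mono {f} f⊢ (entail {a ∷ as} {b ∷ bs} A⊢B) =
      subst₂ _≤V_ (sym (mapTerm-⋀ f a as)) (sym (mapTerm-⋁ f b bs)) (entail (f⊢ A⊢B))

    ▹-mono : ∀ x {u v} → u ≤V v → x ▹ u ≤V x ▹ v
    ▹-mono x {u} {v} u≤v = subst₂ _≤V_ (sym (▹-mapTerm x u)) (sym (▹-mapTerm x v))
      (mapTerm-mono (translation-preserves-⊢ x e (λ z → sym (identityʳ (x · z)))) u≤v)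

    ◃-mono : ∀ y {u v} → u ≤V v → u ◃ y ≤V v ◃ y
    ◃-mono y {u} {v} u≤v = subst₂ _≤V_ (sym (◃-mapTerm y u)) (sym (◃-mapTerm y v))
      (mapTerm-mono (translation-preserves-⊢ e y (λ z → cong (_· y) (sym (identityˡ z)))) u≤v)

    ∧-comm : ∀ {p q} → p ∧ q ≤V q ∧ p
    ∧-comm = ∧-glb ∧-lbʳ ∧-lbˡ

    ∨-distribˡ-∧ : ∀ {p q r} → (p ∨ q) ∧ (p ∨ r) ≤V p ∨ (q ∧ r)
    ∨-distribˡ-∧ = ≤V-trans distrib (∨-lub (≤V-trans ∧-lbʳ ∨-ubˡ)
      (≤V-trans ∧-comm (≤V-trans distrib (∨-lub (≤V-trans ∧-lbʳ ∨-ubˡ) (≤V-trans ∧-comm ∨-ubʳ)))))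

    cut : ∀ {p q r s t} → p ∧ q ≤V r ∨ s → p ∧ s ≤V r ∨ t → p ∧ q ≤V r ∨ t
    cut q≤s s≤t = ≤V-trans (∧-glb ∧-lbˡ q≤s)
      (≤V-trans distrib (∨-lub (≤V-trans ∧-lbʳ ∨-ubˡ) s≤t))

    module _ (a b : Term G) where
      private
        infix 4 _≼_

        _≼_ : Term G → Term G → Set
        u ≼ v = _≤[_,_]_ G E u a b v

      ≤[]-quotient : DefinesLatticeQuotient G E _≼_
      ≤[]-quotient = record
        { refl′   = λ x y → ≤V-trans ∧-lbʳ ∨-ubʳ
        ; trans′  = λ u≼v v≼w x y → cut (u≼v x y) (v≼w x y)
        ; extends = λ u≤v x y → ≤V-trans ∧-lbʳ (≤V-trans (◃-mono y u≤v) ∨-ubʳ)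
        ; meet    = λ w≼u w≼v x y → ≤V-trans (∧-glb (w≼u x y) (w≼v x y)) ∨-distribˡ-∧
        ; join    = λ u≼w v≼w x y → ≤V-trans distrib (∨-lub (u≼w x y) (v≼w x y))
        }

      ≤[]-left-invariant : ∀ {u v} z → u ≼ v → z ▹ u ≼ z ▹ v
      ≤[]-left-invariant {u} {v} z u≼v x y =
        subst₂ _≤V_ (cong₂ _∧_ (▹-▹-cancel z x a) (▹-◃ z y u))
                    (cong₂ _∨_ (▹-▹-cancel z x b) (▹-◃ z y v))
                    (▹-mono z (u≼v (z ⁻¹ · x) y))

      ≤[]-right-invariant : ∀ {u v} z → u ≼ v → u ◃ z ≼ v ◃ z
      ≤[]-right-invariant {u} {v} z u≼v x y =
        subst₂ _≤V_ (cong (x ▹ a ∧_) (sym (◃-◃ z y u)))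
                    (cong (x ▹ b ∨_) (sym (◃-◃ z y v)))
                    (u≼v x (z · y))

      ≤[]-invariant : ActionInvariant G E _≼_
      ≤[]-invariant = record { left = ≤[]-left-invariant ; right = ≤[]-right-invariant }

proposition7p2 : (G : PreorderedGroup) (E : RegularEntailment G) →
    (∀ (a b : Term G) →
    DefinesLatticeQuotient G E (λ u v → _≤[_,_]_ G E u a b v)
    × ActionInvariant G E (λ u v → _≤[_,_]_ G E u a b v))
    × (∀ (a b : PreorderedGroup.Carrier G) →
    _≤[_,_]_ G E (gen b) (gen a) (gen b) (gen a))
proposition7p2 G E =
  (λ a b → ≤[]-quotient G E a b , ≤[]-invariant G E a b) ,
  λ a b x y → entail (RegularEntailment.R5 E a b x y)
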